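{- Let $A_k(x)=\sum_{\pi\in\mathfrak{S}_k}x^{\mathrm{des}(\pi)}$, and define $\widetilde{A}_0(x)=1$, $\widetilde{A}_n(x)=1+x\sum_{k=1}^{n}\binom{n}{k}A_k(x)$ for $n\ge1$. Then for all $n\ge 1$, $$\widetilde{A}_n(x)=\sum_{j=1}^{n}\binom{n}{j}(x-1)^{j-1}\widetilde{A}_{n-j}(x)+x^n,$$ equivalently $\widetilde{A}_n(x)=\sum_{k=0}^{n-1}\binom{n}{k}(x-1)^{n-k-1}\widetilde{A}_k(x)+x^n$.
   Context: $\mathfrak{S}_k$ is the symmetric group on $[k]$; $\mathrm{des}(\pi)$ is the number of $i\in[k-1]$ with $\pi(i)>\pi(i+1)$. -}

module Defs where

open import Data.Nat using (ℕ; zero; suc)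
open import Data.Nat.Combinatorics using (_C_)
open import Data.Fin using (Fin; _<?_)
open import Data.Fin.Properties using (_≟_)
open import Data.List using (List; []; _∷_; map; concatMap; allFin; filter)
open import Data.Integer using (ℤ; +_; _+_; _*_; _-_; _^_; 0ℤ; 1ℤ)
open import Relation.Nullary.Decidable using (does)
open import Data.Bool using (if_then_else_)

words : (m n : ℕ) → List (List (Fin m))
words m zero = [] ∷ []
words m (suc n) = concatMap (λ w → map (_∷ w) (allFin m)) (words m n)

-- The symmetric group 𝔖_k, as the list of all injective words of length k
-- over Fin k (one-line notation π(1) π(2) … π(k)), each listed exactly once.
module _ (k : ℕ) where
  open import Data.List.Relation.Unary.Unique.DecPropositional (_≟_ {n = k}) using (unique?)
  Sym : List (List (Fin k))
  Sym = filter unique? (words k k)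

des : {k : ℕ} → List (Fin k) → ℕ
des [] = 0
des (a ∷ []) = 0
des (a ∷ b ∷ w) = (if does (b <? a) then 1 else 0) Data.Nat.+ des (b ∷ w)

sumℤ : List ℤ → ℤ
sumℤ [] = 0ℤ
sumℤ (a ∷ as) = a + sumℤ as

∑₁ : ℕ → (ℕ → ℤ) → ℤ
∑₁ zero f = 0ℤ
∑₁ (suc n) f = ∑₁ n f + f (suc n)

A : ℤ → ℕ → ℤ
A x k = sumℤ (map (λ π → x ^ des π) (Sym k))

Ã : ℤ → ℕ → ℤ
Ã x zero = 1ℤ
Ã x (suc n) = 1ℤ + x * ∑₁ (suc n) (λ k → (+ (suc n C k)) * A x k)

-- Read sequences as exponential generating functions, so that the binomial
-- convolution _⋆_ multiplies them, and put y = x - 1, Y = (e^{yt} - 1) / y.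
-- Then Ã = (1 - x) e^t + x A e^t, and the theorem says Ã = Y Ã + e^{xt}.
-- Sorting the permutations in 𝔖_{m+1} by the rank of their first letter yields
-- the Eulerian recurrence A = 1 + Y A, hence Y Ã = (1 - x) Y e^t + x (A - 1) e^t,
-- and adding e^{xt} = e^t + y Y e^t gives back Ã.

module Submission where

open import Defs
open import Data.Nat using (ℕ; suc; _∸_)
open import Data.Nat.Combinatorics using (_C_)
open import Data.Integer using (ℤ; +_; _+_; _*_; _-_; _^_; 1ℤ)
open import Relation.Binary.PropositionalEquality using (_≡_)

open import Data.Bool using (Bool; true; false; if_then_else_; _∧_; not)
open import Data.Bool.ListAction using (all)
open import Data.Bool.Properties using (∧-commutativeMonoid; ∧-identityʳ)
open import Algebra.Solver.CommutativeMonoid ∧-commutativeMonoid using (_⊕_; _⊜_) renaming (solve to ∧-solve)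
open import Data.Fin as Fin using (Fin; toℕ; inject₁; _<?_)
open import Data.Fin.Properties using (_≟_; toℕ<n; toℕ-inject₁; toℕ-fromℕ)
open import Data.Integer using (0ℤ)
open import Data.Integer.Properties
  using (+-*-semiring; pos-+; +-identityˡ; +-identityʳ; +-assoc; *-distribˡ-+; *-distribʳ-+;
         *-zeroˡ; *-zeroʳ; *-identityˡ; *-identityʳ; ^-zeroˡ)
open import Algebra.Properties.Semiring.Sum +-*-semiring
  using (sum; sum-cong-≗; ∑-distrib-+; *-distribˡ-sum; sum-init-last; sum-replicate-zero)
open import Data.Integer.Tactic.RingSolver using (solve-∀)
open import Data.List using (List; []; _∷_; map; concatMap; allFin; filter; _++_; tabulate)
open import Data.List.Properties using (map-∘)
open import Data.List.Relation.Unary.All using (all?)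
open import Data.Nat as ℕ using (zero; _<ᵇ_; _≤_; _<_; s≤s)
open import Data.Nat.Combinatorics using (nCk+nC[k+1]≡[n+1]C[k+1]; k>n⇒nCk≡0)
open import Data.Nat.Properties using (n<1+n; +-∸-assoc; +-suc; suc-injective; m≤n⇒m≤1+n; ≤-refl)
open import Function using (_∘_; id)
open import Relation.Binary.PropositionalEquality using (_≗_; refl; sym; trans; cong; cong₂; module ≡-Reasoning)
open import Relation.Nullary.Decidable using (does; ¬?)
open import Relation.Unary using (Decidable)

∑< : ℕ → (ℕ → ℤ) → ℤ
∑< n f = sum {n} (f ∘ toℕ)

module _ (n : ℕ) where

  ∑<-cong : {f g : ℕ → ℤ} → f ≗ g → ∑< n f ≡ ∑< n g
  ∑<-cong f≗g = sum-cong-≗ {n} (f≗g ∘ toℕ)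

  ∑<-cong-< : {f g : ℕ → ℤ} → (∀ i → i < n → f i ≡ g i) → ∑< n f ≡ ∑< n g
  ∑<-cong-< f≡g = sum-cong-≗ {n} (λ i → f≡g (toℕ i) (toℕ<n i))

  ∑<-+ : (f g : ℕ → ℤ) → ∑< n (λ i → f i + g i) ≡ ∑< n f + ∑< n g
  ∑<-+ f g = ∑-distrib-+ {n} (f ∘ toℕ) (g ∘ toℕ)

  ∑<-* : (c : ℤ) (f : ℕ → ℤ) → ∑< n (λ i → c * f i) ≡ c * ∑< n f
  ∑<-* c f = sym (*-distribˡ-sum {n} c (f ∘ toℕ))

  ∑<-zero : ∑< n (λ _ → 0ℤ) ≡ 0ℤ
  ∑<-zero = sum-replicate-zero n

∑<-suc : ∀ n (f : ℕ → ℤ) → ∑< (suc n) f ≡ ∑< n f + f n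
∑<-suc n f = trans (sum-init-last {n} (f ∘ toℕ))
  (cong₂ _+_ (∑<-init) (cong f (toℕ-fromℕ n)))
  where
  ∑<-init : sum {n} (f ∘ toℕ ∘ inject₁) ≡ ∑< n f
  ∑<-init = sum-cong-≗ {n} (cong f ∘ toℕ-inject₁)

∑<-below : ∀ n r (f : ℕ → ℤ) → r ≤ n → ∑< n (λ i → if i <ᵇ r then f i else 0ℤ) ≡ ∑< r f
∑<-below n zero f _ = ∑<-zero n
∑<-below (suc n) (suc r) f (s≤s r≤n) = cong (_+_ (f 0)) (∑<-below n r (f ∘ suc) r≤n)

∑₁≡∑< : ∀ n (f : ℕ → ℤ) → ∑₁ n f ≡ ∑< n (f ∘ suc)
∑₁≡∑< zero f = refl
∑₁≡∑< (suc n) f = trans (cong (_+ f (suc n)) (∑₁≡∑< n f)) (sym (∑<-suc n (f ∘ suc)))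

private variable
  U V : Set

sumℤ-++ : ∀ (F : U → ℤ) xs ys → sumℤ (map F (xs ++ ys)) ≡ sumℤ (map F xs) + sumℤ (map F ys)
sumℤ-++ F [] ys = sym (+-identityˡ _)
sumℤ-++ F (x ∷ xs) ys = trans (cong (_+_ (F x)) (sumℤ-++ F xs ys)) (sym (+-assoc (F x) _ _))

sumℤ-cong : ∀ {F G : U → ℤ} → F ≗ G → ∀ xs → sumℤ (map F xs) ≡ sumℤ (map G xs)
sumℤ-cong F≗G [] = refl
sumℤ-cong F≗G (x ∷ xs) = cong₂ _+_ (F≗G x) (sumℤ-cong F≗G xs)

sumℤ-* : ∀ c (F : U → ℤ) xs → sumℤ (map (λ a → c * F a) xs) ≡ c * sumℤ (map F xs)
sumℤ-* c F [] = sym (*-zeroʳ c)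
sumℤ-* c F (x ∷ xs) = trans (cong (_+_ (c * F x)) (sumℤ-* c F xs)) (sym (*-distribˡ-+ c (F x) _))

sumℤ-filter : ∀ {p} {Q : U → Set p} (Q? : Decidable Q) (F : U → ℤ) xs →
  sumℤ (map F (filter Q? xs)) ≡ sumℤ (map (λ a → if does (Q? a) then F a else 0ℤ) xs)
sumℤ-filter Q? F [] = refl
sumℤ-filter Q? F (x ∷ xs) with does (Q? x)
... | true  = cong (_+_ (F x)) (sumℤ-filter Q? F xs)
... | false = trans (sumℤ-filter Q? F xs) (sym (+-identityˡ _))

sumℤ-concatMap : ∀ (F : V → ℤ) (g : U → List V) xs →
  sumℤ (map F (concatMap g xs)) ≡ sumℤ (map (λ a → sumℤ (map F (g a))) xs)
sumℤ-concatMap F g [] = refl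
sumℤ-concatMap F g (x ∷ xs) =
  trans (sumℤ-++ F (g x) (concatMap g xs)) (cong (_+_ (sumℤ (map F (g x)))) (sumℤ-concatMap F g xs))

sumℤ-tabulate : ∀ {k} (F : U → ℤ) (g : Fin k → U) → sumℤ (map F (tabulate g)) ≡ sum (F ∘ g)
sumℤ-tabulate {k = zero} F g = refl
sumℤ-tabulate {k = suc k} F g = cong (_+_ (F (g Fin.zero))) (sumℤ-tabulate F (g ∘ Fin.suc))

sumℤ-sum-comm : ∀ {k} (F : Fin k → U → ℤ) xs →
  sumℤ (map (λ w → sum (λ b → F b w)) xs) ≡ sum (λ b → sumℤ (map (F b) xs))
sumℤ-sum-comm {k = k} F [] = sym (sum-replicate-zero k)
sumℤ-sum-comm {k = k} F (x ∷ xs) = trans (cong (_+_ (sum (λ b → F b x))) (sumℤ-sum-comm F xs))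
                                    (sym (∑-distrib-+ {k} (λ b → F b x) (λ b → sumℤ (map (F b) xs))))

sumℤ-words-suc : ∀ k n (F : List (Fin k) → ℤ) →
  sumℤ (map F (words k (suc n))) ≡ sum (λ b → sumℤ (map (λ w → F (b ∷ w)) (words k n)))
sumℤ-words-suc k n F = begin
  sumℤ (map F (concatMap (λ w → map (_∷ w) (allFin k)) (words k n)))
    ≡⟨ sumℤ-concatMap F (λ w → map (_∷ w) (allFin k)) (words k n) ⟩
  sumℤ (map (λ w → sumℤ (map F (map (_∷ w) (allFin k)))) (words k n))
    ≡⟨ sumℤ-cong (λ w → trans (cong sumℤ (sym (map-∘ (allFin k)))) (sumℤ-tabulate (λ b → F (b ∷ w)) id)) (words k n) ⟩
  sumℤ (map (λ w → sum (λ b → F (b ∷ w))) (words k n))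
    ≡⟨ sumℤ-sum-comm (λ b w → F (b ∷ w)) (words k n) ⟩
  sum (λ b → sumℤ (map (λ w → F (b ∷ w)) (words k n))) ∎
  where open ≡-Reasoning

-- Binomial convolution

convTerm : (ℕ → ℤ) → (ℕ → ℤ) → ℕ → ℕ → ℤ
convTerm f g n j = + (n C j) * f j * g (n ∸ j)

infixl 7 _⋆_
_⋆_ : (ℕ → ℤ) → (ℕ → ℤ) → ℕ → ℤ
(f ⋆ g) n = ∑< (suc n) (convTerm f g n)

⋆-congˡ : ∀ f {g g′ : ℕ → ℤ} → g ≗ g′ → f ⋆ g ≗ f ⋆ g′
⋆-congˡ f g≗g′ n = ∑<-cong (suc n) (λ j → cong (+ (n C j) * f j *_) (g≗g′ (n ∸ j)))

⋆-congʳ : ∀ g {f f′ : ℕ → ℤ} → f ≗ f′ → f ⋆ g ≗ f′ ⋆ g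
⋆-congʳ g f≗f′ n = ∑<-cong (suc n) (λ j → cong (λ a → + (n C j) * a * g (n ∸ j)) (f≗f′ j))

⋆-distribʳ-+ : ∀ (f g h : ℕ → ℤ) → (λ i → f i + g i) ⋆ h ≗ λ n → (f ⋆ h) n + (g ⋆ h) n
⋆-distribʳ-+ f g h n = begin
  ((λ i → f i + g i) ⋆ h) n
    ≡⟨ ∑<-cong (suc n) (λ j → distrib (+ (n C j)) (f j) (g j) (h (n ∸ j))) ⟩
  ∑< (suc n) (λ j → convTerm f h n j + convTerm g h n j)
    ≡⟨ ∑<-+ (suc n) (convTerm f h n) (convTerm g h n) ⟩
  (f ⋆ h) n + (g ⋆ h) n ∎
  where
  open ≡-Reasoning
  distrib : ∀ c a b t → c * (a + b) * t ≡ c * a * t + c * b * t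
  distrib = solve-∀

⋆-distribˡ-+ : ∀ (f g h : ℕ → ℤ) → f ⋆ (λ i → g i + h i) ≗ λ n → (f ⋆ g) n + (f ⋆ h) n
⋆-distribˡ-+ f g h n = begin
  (f ⋆ (λ i → g i + h i)) n
    ≡⟨ ∑<-cong (suc n) (λ j → distrib (+ (n C j)) (f j) (g (n ∸ j)) (h (n ∸ j))) ⟩
  ∑< (suc n) (λ j → convTerm f g n j + convTerm f h n j)
    ≡⟨ ∑<-+ (suc n) (convTerm f g n) (convTerm f h n) ⟩
  (f ⋆ g) n + (f ⋆ h) n ∎
  where
  open ≡-Reasoning
  distrib : ∀ c a s t → c * a * (s + t) ≡ c * a * s + c * a * t
  distrib = solve-∀

⋆-scalarˡ : ∀ c (f g : ℕ → ℤ) → (λ i → c * f i) ⋆ g ≗ λ n → c * (f ⋆ g) n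
⋆-scalarˡ c f g n = trans (∑<-cong (suc n) (λ j → commute c (+ (n C j)) (f j) (g (n ∸ j))))
                          (∑<-* (suc n) c (convTerm f g n))
  where
  commute : ∀ c b a t → b * (c * a) * t ≡ c * (b * a * t)
  commute = solve-∀

⋆-scalarʳ : ∀ c (f g : ℕ → ℤ) → f ⋆ (λ i → c * g i) ≗ λ n → c * (f ⋆ g) n
⋆-scalarʳ c f g n = trans (∑<-cong (suc n) (λ j → commute c (+ (n C j)) (f j) (g (n ∸ j))))
                          (∑<-* (suc n) c (convTerm f g n))
  where
  commute : ∀ c b a t → b * a * (c * t) ≡ c * (b * a * t)
  commute = solve-∀

pascalℤ : ∀ n k → + (suc n C suc k) ≡ + (n C k) + + (n C suc k)
pascalℤ n k = trans (cong +_ (sym (nCk+nC[k+1]≡[n+1]C[k+1] n k))) (pos-+ (n C k) (n C suc k))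

⋆-suc : ∀ (f g : ℕ → ℤ) n → (f ⋆ g) (suc n) ≡ ((f ∘ suc) ⋆ g) n + (f ⋆ (g ∘ suc)) n
⋆-suc f g n = begin
  first + ∑< (suc n) (λ j → + (suc n C suc j) * f (suc j) * g (n ∸ j))
    ≡⟨ cong (_+_ first) (trans (∑<-cong (suc n) pascal-split) (∑<-+ (suc n) (convTerm (f ∘ suc) g n) upper)) ⟩
  first + (((f ∘ suc) ⋆ g) n + ∑< (suc n) upper)
    ≡⟨ cong (λ s → first + (((f ∘ suc) ⋆ g) n + s)) upper-shift ⟩
  first + (((f ∘ suc) ⋆ g) n + ∑< n (λ j → + (n C suc j) * f (suc j) * g (suc (n ∸ suc j))))
    ≡⟨ +-comm-middle first (((f ∘ suc) ⋆ g) n) _ ⟩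
  ((f ∘ suc) ⋆ g) n + (f ⋆ (g ∘ suc)) n ∎
  where
  open ≡-Reasoning
  first = 1ℤ * f 0 * g (suc n)
  upper : ℕ → ℤ
  upper j = + (n C suc j) * f (suc j) * g (n ∸ j)
  pascal-split : ∀ j → + (suc n C suc j) * f (suc j) * g (n ∸ j)
                     ≡ + (n C j) * f (suc j) * g (n ∸ j) + upper j
  pascal-split j = trans (cong (λ c → c * f (suc j) * g (n ∸ j)) (pascalℤ n j))
                         (distrib (+ (n C j)) (+ (n C suc j)) (f (suc j)) (g (n ∸ j)))
    where
    distrib : ∀ a b p q → (a + b) * p * q ≡ a * p * q + b * p * q
    distrib = solve-∀
  upper-shift : ∑< (suc n) upper ≡ ∑< n (λ j → + (n C suc j) * f (suc j) * g (suc (n ∸ suc j)))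
  upper-shift = begin
    ∑< (suc n) upper                  ≡⟨ ∑<-suc n upper ⟩
    ∑< n upper + upper n              ≡⟨ cong (λ c → ∑< n upper + + c * f (suc n) * g (n ∸ n)) (k>n⇒nCk≡0 (n<1+n n)) ⟩
    ∑< n upper + 0ℤ                   ≡⟨ +-identityʳ _ ⟩
    ∑< n upper                        ≡⟨ ∑<-cong-< n (λ j j<n → cong (λ m → + (n C suc j) * f (suc j) * g m) (+-∸-assoc 1 j<n)) ⟩
    _ ∎
  +-comm-middle : ∀ a b c → a + (b + c) ≡ b + (a + c)
  +-comm-middle = solve-∀

⋆-assoc : ∀ (f g h : ℕ → ℤ) → (f ⋆ g) ⋆ h ≗ f ⋆ (g ⋆ h)
⋆-assoc f g h zero = regroup (f 0) (g 0) (h 0)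
  where
  regroup : ∀ a b c → 1ℤ * (1ℤ * a * b + 0ℤ) * c + 0ℤ ≡ 1ℤ * a * (1ℤ * b * c + 0ℤ) + 0ℤ
  regroup = solve-∀
⋆-assoc f g h (suc n) = begin
  ((f ⋆ g) ⋆ h) (suc n)
    ≡⟨ ⋆-suc (f ⋆ g) h n ⟩
  (((f ⋆ g) ∘ suc) ⋆ h) n + ((f ⋆ g) ⋆ (h ∘ suc)) n
    ≡⟨ cong (_+ ((f ⋆ g) ⋆ (h ∘ suc)) n) (⋆-congʳ h (⋆-suc f g) n) ⟩
  ((λ i → ((f ∘ suc) ⋆ g) i + (f ⋆ (g ∘ suc)) i) ⋆ h) n + ((f ⋆ g) ⋆ (h ∘ suc)) n
    ≡⟨ cong (_+ ((f ⋆ g) ⋆ (h ∘ suc)) n) (⋆-distribʳ-+ ((f ∘ suc) ⋆ g) (f ⋆ (g ∘ suc)) h n) ⟩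
  (((f ∘ suc) ⋆ g) ⋆ h) n + ((f ⋆ (g ∘ suc)) ⋆ h) n + ((f ⋆ g) ⋆ (h ∘ suc)) n
    ≡⟨ cong₂ _+_ (cong₂ _+_ (⋆-assoc (f ∘ suc) g h n) (⋆-assoc f (g ∘ suc) h n)) (⋆-assoc f g (h ∘ suc) n) ⟩
  ((f ∘ suc) ⋆ (g ⋆ h)) n + (f ⋆ ((g ∘ suc) ⋆ h)) n + (f ⋆ (g ⋆ (h ∘ suc))) n
    ≡⟨ +-assoc (((f ∘ suc) ⋆ (g ⋆ h)) n) _ _ ⟩
  ((f ∘ suc) ⋆ (g ⋆ h)) n + ((f ⋆ ((g ∘ suc) ⋆ h)) n + (f ⋆ (g ⋆ (h ∘ suc))) n)
    ≡⟨ cong (_+_ (((f ∘ suc) ⋆ (g ⋆ h)) n)) (sym (⋆-distribˡ-+ f ((g ∘ suc) ⋆ h) (g ⋆ (h ∘ suc)) n)) ⟩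
  ((f ∘ suc) ⋆ (g ⋆ h)) n + (f ⋆ (λ i → ((g ∘ suc) ⋆ h) i + (g ⋆ (h ∘ suc)) i)) n
    ≡⟨ cong (_+_ (((f ∘ suc) ⋆ (g ⋆ h)) n)) (⋆-congˡ f (λ i → sym (⋆-suc g h i)) n) ⟩
  ((f ∘ suc) ⋆ (g ⋆ h)) n + (f ⋆ ((g ⋆ h) ∘ suc)) n
    ≡⟨ sym (⋆-suc f (g ⋆ h) n) ⟩
  (f ⋆ (g ⋆ h)) (suc n) ∎
  where open ≡-Reasoning

δ : ℕ → ℤ
δ zero = 1ℤ
δ (suc _) = 0ℤ

⋆-identityˡ : ∀ (g : ℕ → ℤ) → δ ⋆ g ≗ g
⋆-identityˡ g n = begin
  1ℤ * 1ℤ * g n + ∑< n (λ j → + (n C suc j) * 0ℤ * g (n ∸ suc j))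
    ≡⟨ cong (_+_ (1ℤ * 1ℤ * g n)) (trans (∑<-cong n (λ j → annihilate (+ (n C suc j)) (g (n ∸ suc j)))) (∑<-zero n)) ⟩
  1ℤ * 1ℤ * g n + 0ℤ
    ≡⟨ unit (g n) ⟩
  g n ∎
  where
  open ≡-Reasoning
  annihilate : ∀ a b → a * 0ℤ * b ≡ 0ℤ
  annihilate = solve-∀
  unit : ∀ a → 1ℤ * 1ℤ * a + 0ℤ ≡ a
  unit = solve-∀

⋆-pow : ∀ a b → (a ^_) ⋆ (b ^_) ≗ (a + b) ^_
⋆-pow a b zero = refl
⋆-pow a b (suc n) = begin
  ((a ^_) ⋆ (b ^_)) (suc n)
    ≡⟨ ⋆-suc (a ^_) (b ^_) n ⟩
  ((λ j → a * a ^ j) ⋆ (b ^_)) n + ((a ^_) ⋆ (λ j → b * b ^ j)) n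
    ≡⟨ cong₂ _+_ (⋆-scalarˡ a (a ^_) (b ^_) n) (⋆-scalarʳ b (a ^_) (b ^_) n) ⟩
  a * ((a ^_) ⋆ (b ^_)) n + b * ((a ^_) ⋆ (b ^_)) n
    ≡⟨ cong (λ s → a * s + b * s) (⋆-pow a b n) ⟩
  a * (a + b) ^ n + b * (a + b) ^ n
    ≡⟨ sym (*-distribʳ-+ ((a + b) ^ n) a b) ⟩
  (a + b) * (a + b) ^ n ∎
  where open ≡-Reasoning

-- Permutations by their first letter

-- refinedEulerian x n r = Σ x ^ des π over π ∈ 𝔖_{n+1} with π(1) = r + 1: the next
-- letter has some rank i among the remaining n, and it is a descent iff i < r.
refinedEulerian : ℤ → ℕ → ℕ → ℤ
refinedEulerian x zero r = 1ℤ
refinedEulerian x (suc n) r = ∑< (suc n) (λ i → (if i <ᵇ r then x else 1ℤ) * refinedEulerian x n i)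

refinedEulerian-suc : ∀ x n r → r ≤ suc n →
  refinedEulerian x (suc n) r ≡ ∑< (suc n) (refinedEulerian x n) + (x - 1ℤ) * ∑< r (refinedEulerian x n)
refinedEulerian-suc x n r r≤1+n = begin
  ∑< (suc n) (λ i → (if i <ᵇ r then x else 1ℤ) * P i)
    ≡⟨ ∑<-cong (suc n) split ⟩
  ∑< (suc n) (λ i → P i + (x - 1ℤ) * P<r i)
    ≡⟨ ∑<-+ (suc n) P (λ i → (x - 1ℤ) * P<r i) ⟩
  ∑< (suc n) P + ∑< (suc n) (λ i → (x - 1ℤ) * P<r i)
    ≡⟨ cong (_+_ (∑< (suc n) P)) (∑<-* (suc n) (x - 1ℤ) P<r) ⟩
  ∑< (suc n) P + (x - 1ℤ) * ∑< (suc n) P<r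
    ≡⟨ cong (λ s → ∑< (suc n) P + (x - 1ℤ) * s) (∑<-below (suc n) r P r≤1+n) ⟩
  ∑< (suc n) P + (x - 1ℤ) * ∑< r P ∎
  where
  open ≡-Reasoning
  P P<r : ℕ → ℤ
  P = refinedEulerian x n
  P<r i = if i <ᵇ r then P i else 0ℤ
  split : ∀ i → (if i <ᵇ r then x else 1ℤ) * P i ≡ P i + (x - 1ℤ) * P<r i
  split i with i <ᵇ r
  ... | true  = descent x (P i)
    where
    descent : ∀ x p → x * p ≡ p + (x - 1ℤ) * p
    descent = solve-∀
  ... | false = ascent x (P i)
    where
    ascent : ∀ x p → 1ℤ * p ≡ p + (x - 1ℤ) * 0ℤ
    ascent = solve-∀

-- At r = m + 1 this is (shiftedPow y ⋆ a) (m + 1).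
prefixConv : ℤ → (ℕ → ℤ) → ℕ → ℕ → ℤ
prefixConv y a r m = ∑< (suc m) (λ j → + (r C suc j) * y ^ j * a (m ∸ j))

prefixConv-suc : ∀ y a r m →
  prefixConv y a (suc r) (suc m) ≡ prefixConv y a r (suc m) + (a (suc m) + y * prefixConv y a r m)
prefixConv-suc y a r m = begin
  + (suc r C 1) * 1ℤ * a (suc m) + ∑< (suc m) (λ j → + (suc r C suc (suc j)) * y ^ suc j * a (m ∸ j))
    ≡⟨ cong₂ (λ c s → c * 1ℤ * a (suc m) + s) (pascalℤ r 0) (∑<-cong (suc m) pascal-split) ⟩
  (1ℤ + + (r C 1)) * 1ℤ * a (suc m) + ∑< (suc m) (λ j → higher j + y * lower j)
    ≡⟨ cong (_+_ ((1ℤ + + (r C 1)) * 1ℤ * a (suc m))) (trans (∑<-+ (suc m) higher (λ j → y * lower j))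
                                                          (cong (_+_ (∑< (suc m) higher)) (∑<-* (suc m) y lower))) ⟩
  (1ℤ + + (r C 1)) * 1ℤ * a (suc m) + (∑< (suc m) higher + y * ∑< (suc m) lower)
    ≡⟨ regroup (a (suc m)) (+ (r C 1)) (∑< (suc m) higher) (y * ∑< (suc m) lower) ⟩
  prefixConv y a r (suc m) + (a (suc m) + y * prefixConv y a r m) ∎
  where
  open ≡-Reasoning
  higher lower : ℕ → ℤ
  higher j = + (r C suc (suc j)) * y ^ suc j * a (m ∸ j)
  lower j = + (r C suc j) * y ^ j * a (m ∸ j)
  pascal-split : ∀ j → + (suc r C suc (suc j)) * y ^ suc j * a (m ∸ j) ≡ higher j + y * lower j
  pascal-split j = trans (cong (λ c → c * y ^ suc j * a (m ∸ j)) (pascalℤ r (suc j)))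
                         (distrib (+ (r C suc j)) (+ (r C suc (suc j))) y (y ^ j) (a (m ∸ j)))
    where
    distrib : ∀ p q y w t → (p + q) * (y * w) * t ≡ q * (y * w) * t + y * (p * w * t)
    distrib = solve-∀
  regroup : ∀ a c h l → (1ℤ + c) * 1ℤ * a + (h + l) ≡ c * 1ℤ * a + h + (a + l)
  regroup = solve-∀

card : ∀ {k} → (Fin k → Bool) → ℕ
card {zero} s = 0
card {suc k} s = (if s Fin.zero then 1 else 0) ℕ.+ card (s ∘ Fin.suc)

rank : ∀ {k} → (Fin k → Bool) → ℕ → ℕ
rank s zero = 0
rank {zero} s (suc m) = 0
rank {suc k} s (suc m) = (if s Fin.zero then 1 else 0) ℕ.+ rank (s ∘ Fin.suc) m

remove : ∀ {k} → Fin k → (Fin k → Bool) → Fin k → Bool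
remove b s c = not (does (b ≟ c)) ∧ s c

card-full : ∀ k → card {k} (λ _ → true) ≡ k
card-full zero = refl
card-full (suc k) = cong suc (card-full k)

card-remove : ∀ {k} (b : Fin k) s → s b ≡ true → suc (card (remove b s)) ≡ card s
card-remove Fin.zero s sb≡true rewrite sb≡true = refl
card-remove {suc k} (Fin.suc b) s sb≡true =
  trans (sym (+-suc (if s Fin.zero then 1 else 0) _))
        (cong ((if s Fin.zero then 1 else 0) ℕ.+_) (card-remove b (s ∘ Fin.suc) sb≡true))

rank-remove : ∀ {k} (b : Fin k) s → rank (remove b s) (toℕ b) ≡ rank s (toℕ b)
rank-remove Fin.zero s = refl
rank-remove (Fin.suc b) s = cong ((if s Fin.zero then 1 else 0) ℕ.+_) (rank-remove b (s ∘ Fin.suc))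

-- Listed in increasing order, the elements of s get the ranks 0, …, card s - 1,
-- and b < a iff rank b < rank a.
sum-by-rank : ∀ {k} (s : Fin k → Bool) a (φ : Bool → ℕ → ℤ) →
  sum (λ b → if s b then φ (toℕ b <ᵇ a) (rank s (toℕ b)) else 0ℤ) ≡ ∑< (card s) (λ i → φ (i <ᵇ rank s a) i)
sum-by-rank {zero} s a φ = refl
sum-by-rank {suc k} s zero φ with s Fin.zero
... | true  = cong (_+_ (φ false 0)) (sum-by-rank (s ∘ Fin.suc) 0 (λ β i → φ β (suc i)))
... | false = trans (+-identityˡ _) (sum-by-rank (s ∘ Fin.suc) 0 φ)
sum-by-rank {suc k} s (suc a) φ with s Fin.zero
... | true  = cong (_+_ (φ true 0)) (sum-by-rank (s ∘ Fin.suc) a (λ β i → φ β (suc i)))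
... | false = trans (+-identityˡ _) (sum-by-rank (s ∘ Fin.suc) a φ)

uniqueIn : ∀ {k} → (Fin k → Bool) → List (Fin k) → Bool
uniqueIn s [] = true
uniqueIn s (b ∷ w) = s b ∧ uniqueIn (remove b s) w

all-remove : ∀ {k} (b : Fin k) s w → all (remove b s) w ≡ all (λ c → not (does (b ≟ c))) w ∧ all s w
all-remove b s [] = refl
all-remove b s (c ∷ w) = trans (cong (_∧_ (remove b s c)) (all-remove b s w))
  (∧-solve 4 (λ p q r t → (p ⊕ q) ⊕ (r ⊕ t) ⊜ (p ⊕ r) ⊕ (q ⊕ t)) refl (not (does (b ≟ c))) (s c) _ _)

module _ (k : ℕ) where
  open import Data.List.Relation.Unary.Unique.DecPropositional (_≟_ {n = k}) using (unique?)

  does-all? : ∀ (b : Fin k) w → does (all? (λ c → ¬? (b ≟ c)) w) ≡ all (λ c → not (does (b ≟ c))) w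
  does-all? b [] = refl
  does-all? b (c ∷ w) = cong (_∧_ (not (does (b ≟ c)))) (does-all? b w)

  unique?-∧-all : ∀ s w → does (unique? w) ∧ all s w ≡ uniqueIn s w
  unique?-∧-all s [] = refl
  unique?-∧-all s (b ∷ w) = begin
    (does (all? (λ c → ¬? (b ≟ c)) w) ∧ does (unique? w)) ∧ (s b ∧ all s w)
      ≡⟨ cong (λ d → (d ∧ does (unique? w)) ∧ (s b ∧ all s w)) (does-all? b w) ⟩
    (all (λ c → not (does (b ≟ c))) w ∧ does (unique? w)) ∧ (s b ∧ all s w)
      ≡⟨ ∧-solve 4 (λ p q r t → (p ⊕ q) ⊕ (r ⊕ t) ⊜ r ⊕ (q ⊕ (p ⊕ t))) refl _ (does (unique? w)) (s b) (all s w) ⟩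
    s b ∧ (does (unique? w) ∧ (all (λ c → not (does (b ≟ c))) w ∧ all s w))
      ≡⟨ cong (λ d → s b ∧ (does (unique? w) ∧ d)) (sym (all-remove b s w)) ⟩
    s b ∧ (does (unique? w) ∧ all (remove b s) w)
      ≡⟨ cong (_∧_ (s b)) (unique?-∧-all (remove b s) w) ⟩
    s b ∧ uniqueIn (remove b s) w ∎
    where open ≡-Reasoning

  unique?≡uniqueIn-full : ∀ w → does (unique? w) ≡ uniqueIn (λ _ → true) w
  unique?≡uniqueIn-full w = trans (sym (trans (cong (_∧_ (does (unique? w))) (all-true w)) (∧-identityʳ _)))
                                  (unique?-∧-all (λ _ → true) w)
    where
    all-true : ∀ (w : List (Fin k)) → all (λ _ → true) w ≡ true
    all-true [] = refl
    all-true (c ∷ w) = all-true w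

descentsAfter : ℤ → ∀ {k} → Fin k → (Fin k → Bool) → ℕ → ℤ
descentsAfter x {k} a s n = sumℤ (map (λ w → if uniqueIn s w then x ^ des (a ∷ w) else 0ℤ) (words k n))

pow-des-∷ : ∀ x {k} (a b : Fin k) w → x ^ des (a ∷ b ∷ w) ≡ (if does (b <? a) then x else 1ℤ) * x ^ des (b ∷ w)
pow-des-∷ x a b w with does (b <? a)
... | true  = refl
... | false = sym (*-identityˡ _)

-- When card s ≡ n the counted words are the orderings of s, and the descents
-- of a ∷ w only depend on relative order, that is, on ranks in s.
descentsAfter-rank : ∀ x n {k} (a : Fin k) s → card s ≡ n →
  descentsAfter x a s n ≡ refinedEulerian x n (rank s (toℕ a))
descentsAfter-rank x zero a s _ = refl
descentsAfter-rank x (suc n) {k} a s card≡1+n = begin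
  descentsAfter x a s (suc n)
    ≡⟨ sumℤ-words-suc k n _ ⟩
  sum (λ b → sumℤ (map (λ w → if s b ∧ uniqueIn (remove b s) w then x ^ des (a ∷ b ∷ w) else 0ℤ) (words k n)))
    ≡⟨ sum-cong-≗ {k} (λ b → trans (sumℤ-cong (factor b) (words k n)) (sumℤ-* (weight b) _ (words k n))) ⟩
  sum (λ b → weight b * descentsAfter x b (remove b s) n)
    ≡⟨ sum-cong-≗ {k} by-rank ⟩
  sum (λ b → if s b then φ (toℕ b <ᵇ toℕ a) (rank s (toℕ b)) else 0ℤ)
    ≡⟨ sum-by-rank s (toℕ a) φ ⟩
  ∑< (card s) (λ i → φ (i <ᵇ rank s (toℕ a)) i)
    ≡⟨ cong (λ c → ∑< c (λ i → φ (i <ᵇ rank s (toℕ a)) i)) card≡1+n ⟩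
  refinedEulerian x (suc n) (rank s (toℕ a)) ∎
  where
  open ≡-Reasoning
  weight : Fin k → ℤ
  weight b = if s b then (if does (b <? a) then x else 1ℤ) else 0ℤ
  φ : Bool → ℕ → ℤ
  φ descent i = (if descent then x else 1ℤ) * refinedEulerian x n i
  factor : ∀ b w → (if s b ∧ uniqueIn (remove b s) w then x ^ des (a ∷ b ∷ w) else 0ℤ)
                   ≡ weight b * (if uniqueIn (remove b s) w then x ^ des (b ∷ w) else 0ℤ)
  factor b w with s b | uniqueIn (remove b s) w
  ... | true  | true  = pow-des-∷ x a b w
  ... | true  | false = sym (*-zeroʳ (if does (b <? a) then x else 1ℤ))
  ... | false | u     = sym (*-zeroˡ (if u then x ^ des (b ∷ w) else 0ℤ))
  by-rank : ∀ b → weight b * descentsAfter x b (remove b s) n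
                  ≡ (if s b then φ (toℕ b <ᵇ toℕ a) (rank s (toℕ b)) else 0ℤ)
  by-rank b with s b in sb≡true
  ... | true  = cong ((if does (b <? a) then x else 1ℤ) *_)
                     (trans (descentsAfter-rank x n b (remove b s) (suc-injective (trans (card-remove b s sb≡true) card≡1+n)))
                            (cong (refinedEulerian x n) (rank-remove b s)))
  ... | false = *-zeroˡ (descentsAfter x b (remove b s) n)

A-suc : ∀ x m → A x (suc m) ≡ ∑< (suc m) (refinedEulerian x m)
A-suc x m = begin
  sumℤ (map (λ π → x ^ des π) (filter unique? (words k k)))
    ≡⟨ sumℤ-filter unique? (λ π → x ^ des π) (words k k) ⟩
  sumℤ (map (λ w → if does (unique? w) then x ^ des w else 0ℤ) (words k (suc m)))
    ≡⟨ sumℤ-words-suc k m _ ⟩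
  sum (λ b → sumℤ (map (λ w → if does (unique? (b ∷ w)) then x ^ des (b ∷ w) else 0ℤ) (words k m)))
    ≡⟨ sum-cong-≗ {k} (λ b → sumℤ-cong (λ w → cong (λ u → if u then x ^ des (b ∷ w) else 0ℤ)
                                                    (unique?≡uniqueIn-full k (b ∷ w))) (words k m)) ⟩
  sum (λ b → descentsAfter x b (remove b full) m)
    ≡⟨ sum-cong-≗ {k} (λ b → trans (descentsAfter-rank x m b (remove b full) (suc-injective (trans (card-remove b full refl) (card-full k))))
                                   (cong (refinedEulerian x m) (rank-remove b full))) ⟩
  sum {k} (λ b → refinedEulerian x m (rank full (toℕ b)))
    ≡⟨ sum-by-rank {k} full 0 (λ _ → refinedEulerian x m) ⟩
  ∑< (card full) (refinedEulerian x m)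
    ≡⟨ cong (λ c → ∑< c (refinedEulerian x m)) (card-full k) ⟩
  ∑< (suc m) (refinedEulerian x m) ∎
  where
  open ≡-Reasoning
  k = suc m
  open import Data.List.Relation.Unary.Unique.DecPropositional (_≟_ {n = k}) using (unique?)
  full : Fin k → Bool
  full _ = true

-- The Eulerian recurrence

∑<-refinedEulerian : ∀ x r m → r ≤ suc m → ∑< r (refinedEulerian x m) ≡ prefixConv (x - 1ℤ) (A x) r m
∑<-refinedEulerian x zero m _ = sym (trans (∑<-cong (suc m) (λ j → annihilate (y ^ j) (A x (m ∸ j)))) (∑<-zero (suc m)))
  where
  y = x - 1ℤ
  annihilate : ∀ a b → + 0 * a * b ≡ 0ℤ
  annihilate = solve-∀
∑<-refinedEulerian x (suc zero) zero _ = refl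
∑<-refinedEulerian x (suc r) (suc m) (s≤s r≤1+m) = begin
  ∑< (suc r) (refinedEulerian x (suc m))
    ≡⟨ ∑<-suc r (refinedEulerian x (suc m)) ⟩
  ∑< r (refinedEulerian x (suc m)) + refinedEulerian x (suc m) r
    ≡⟨ cong₂ _+_ (∑<-refinedEulerian x r (suc m) (m≤n⇒m≤1+n r≤1+m)) (refinedEulerian-suc x m r r≤1+m) ⟩
  prefixConv y (A x) r (suc m) + (∑< (suc m) (refinedEulerian x m) + y * ∑< r (refinedEulerian x m))
    ≡⟨ cong₂ (λ a s → prefixConv y (A x) r (suc m) + (a + y * s)) (sym (A-suc x m)) (∑<-refinedEulerian x r m r≤1+m) ⟩
  prefixConv y (A x) r (suc m) + (A x (suc m) + y * prefixConv y (A x) r m)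
    ≡⟨ sym (prefixConv-suc y (A x) r m) ⟩
  prefixConv y (A x) (suc r) (suc m) ∎
  where
  open ≡-Reasoning
  y = x - 1ℤ

-- The exponential generating function (e^{yt} - 1) / y.
shiftedPow : ℤ → ℕ → ℤ
shiftedPow y zero = 0ℤ
shiftedPow y (suc j) = y ^ j

A-recurrence : ∀ x → A x ≗ λ m → δ m + (shiftedPow (x - 1ℤ) ⋆ A x) m
A-recurrence x zero = refl
A-recurrence x (suc m) = begin
  A x (suc m)                                      ≡⟨ A-suc x m ⟩
  ∑< (suc m) (refinedEulerian x m)                 ≡⟨ ∑<-refinedEulerian x (suc m) m ≤-refl ⟩
  prefixConv (x - 1ℤ) (A x) (suc m) m              ≡⟨ no-constant-term (A x (suc m)) _ ⟩
  0ℤ + (1ℤ * 0ℤ * A x (suc m) + prefixConv (x - 1ℤ) (A x) (suc m) m) ∎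
  where
  open ≡-Reasoning
  no-constant-term : ∀ a t → t ≡ 0ℤ + (1ℤ * 0ℤ * a + t)
  no-constant-term = solve-∀

one : ℕ → ℤ
one _ = 1ℤ

Ã-via-A : ∀ x → Ã x ≗ λ m → (1ℤ - x) * one m + x * (A x ⋆ one) m
Ã-via-A x zero = unit x
  where
  unit : ∀ x → 1ℤ ≡ (1ℤ - x) * 1ℤ + x * (1ℤ * 1ℤ * 1ℤ + 0ℤ)
  unit = solve-∀
Ã-via-A x (suc n) = begin
  1ℤ + x * ∑₁ (suc n) (λ k → + (suc n C k) * A x k)
    ≡⟨ cong (λ s → 1ℤ + x * s) (∑₁≡∑< (suc n) (λ k → + (suc n C k) * A x k)) ⟩
  1ℤ + x * ∑< (suc n) (λ j → + (suc n C suc j) * A x (suc j))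
    ≡⟨ cong (λ s → 1ℤ + x * s) (∑<-cong (suc n) (λ j → sym (*-identityʳ (+ (suc n C suc j) * A x (suc j))))) ⟩
  1ℤ + x * ∑< (suc n) (λ j → + (suc n C suc j) * A x (suc j) * 1ℤ)
    ≡⟨ regroup x _ ⟩
  (1ℤ - x) * 1ℤ + x * (1ℤ * 1ℤ * 1ℤ + ∑< (suc n) (λ j → + (suc n C suc j) * A x (suc j) * 1ℤ)) ∎
  where
  open ≡-Reasoning
  regroup : ∀ x s → 1ℤ + x * s ≡ (1ℤ - x) * 1ℤ + x * (1ℤ * 1ℤ * 1ℤ + s)
  regroup = solve-∀

pow-via-shiftedPow : ∀ x m → x ^ m ≡ 1ℤ + (x - 1ℤ) * (shiftedPow (x - 1ℤ) ⋆ one) m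
pow-via-shiftedPow x m = begin
  x ^ m
    ≡⟨ cong (_^ m) (shift x) ⟩
  (y + 1ℤ) ^ m
    ≡⟨ sym (⋆-pow y 1ℤ m) ⟩
  ((y ^_) ⋆ (1ℤ ^_)) m
    ≡⟨ ⋆-congˡ (y ^_) ^-zeroˡ m ⟩
  ((y ^_) ⋆ one) m
    ≡⟨ ⋆-congʳ one split-pow m ⟩
  ((λ j → δ j + y * shiftedPow y j) ⋆ one) m
    ≡⟨ ⋆-distribʳ-+ δ (λ j → y * shiftedPow y j) one m ⟩
  (δ ⋆ one) m + ((λ j → y * shiftedPow y j) ⋆ one) m
    ≡⟨ cong₂ _+_ (⋆-identityˡ one m) (⋆-scalarˡ y (shiftedPow y) one m) ⟩
  1ℤ + y * (shiftedPow y ⋆ one) m ∎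
  where
  open ≡-Reasoning
  y = x - 1ℤ
  shift : ∀ x → x ≡ (x - 1ℤ) + 1ℤ
  shift = solve-∀
  split-pow : ∀ j → y ^ j ≡ δ j + y * shiftedPow y j
  split-pow zero = sym (cong (_+_ 1ℤ) (*-zeroʳ y))
  split-pow (suc j) = sym (+-identityˡ (y * y ^ j))

Ã-recurrence : ∀ x m → Ã x m ≡ (shiftedPow (x - 1ℤ) ⋆ Ã x) m + x ^ m
Ã-recurrence x m = begin
  Ã x m
    ≡⟨ Ã-via-A x m ⟩
  (1ℤ - x) * 1ℤ + x * (A x ⋆ one) m
    ≡⟨ cong (λ s → (1ℤ - x) * 1ℤ + x * s) A⋆one ⟩
  (1ℤ - x) * 1ℤ + x * (1ℤ + ((Y ⋆ A x) ⋆ one) m)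
    ≡⟨ regroup x (Y⋆one) (((Y ⋆ A x) ⋆ one) m) ⟩
  ((1ℤ - x) * Y⋆one + x * ((Y ⋆ A x) ⋆ one) m) + (1ℤ + (x - 1ℤ) * Y⋆one)
    ≡⟨ cong₂ _+_ (sym Y⋆Ã) (sym (pow-via-shiftedPow x m)) ⟩
  (Y ⋆ Ã x) m + x ^ m ∎
  where
  open ≡-Reasoning
  Y = shiftedPow (x - 1ℤ)
  Y⋆one = (Y ⋆ one) m
  A⋆one : (A x ⋆ one) m ≡ 1ℤ + ((Y ⋆ A x) ⋆ one) m
  A⋆one = begin
    (A x ⋆ one) m                            ≡⟨ ⋆-congʳ one (A-recurrence x) m ⟩
    ((λ i → δ i + (Y ⋆ A x) i) ⋆ one) m      ≡⟨ ⋆-distribʳ-+ δ (Y ⋆ A x) one m ⟩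
    (δ ⋆ one) m + ((Y ⋆ A x) ⋆ one) m        ≡⟨ cong (_+ ((Y ⋆ A x) ⋆ one) m) (⋆-identityˡ one m) ⟩
    1ℤ + ((Y ⋆ A x) ⋆ one) m                 ∎
  Y⋆Ã : (Y ⋆ Ã x) m ≡ (1ℤ - x) * Y⋆one + x * ((Y ⋆ A x) ⋆ one) m
  Y⋆Ã = begin
    (Y ⋆ Ã x) m
      ≡⟨ ⋆-congˡ Y (Ã-via-A x) m ⟩
    (Y ⋆ (λ i → (1ℤ - x) * one i + x * (A x ⋆ one) i)) m
      ≡⟨ ⋆-distribˡ-+ Y (λ i → (1ℤ - x) * one i) (λ i → x * (A x ⋆ one) i) m ⟩
    (Y ⋆ (λ i → (1ℤ - x) * one i)) m + (Y ⋆ (λ i → x * (A x ⋆ one) i)) m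
      ≡⟨ cong₂ _+_ (⋆-scalarʳ (1ℤ - x) Y one m) (⋆-scalarʳ x Y (A x ⋆ one) m) ⟩
    (1ℤ - x) * Y⋆one + x * (Y ⋆ (A x ⋆ one)) m
      ≡⟨ cong (λ s → (1ℤ - x) * Y⋆one + x * s) (sym (⋆-assoc Y (A x) one m)) ⟩
    (1ℤ - x) * Y⋆one + x * ((Y ⋆ A x) ⋆ one) m ∎
  regroup : ∀ x g d → (1ℤ - x) * 1ℤ + x * (1ℤ + d) ≡ ((1ℤ - x) * g + x * d) + (1ℤ + (x - 1ℤ) * g)
  regroup = solve-∀

theorem2p12 : (n : ℕ) → (x : ℤ) →
    Ã x (suc n) ≡ ∑₁ (suc n) (λ j → (+ (suc n C j)) * ((x - 1ℤ) ^ (j ∸ 1)) * Ã x (suc n ∸ j)) + x ^ suc n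
theorem2p12 n x = begin
  Ã x (suc n)
    ≡⟨ Ã-recurrence x (suc n) ⟩
  (shiftedPow (x - 1ℤ) ⋆ Ã x) (suc n) + x ^ suc n
    ≡⟨ cong (_+ x ^ suc n) (+-identityˡ (∑< (suc n) (λ j → + (suc n C suc j) * (x - 1ℤ) ^ j * Ã x (n ∸ j)))) ⟩
  ∑< (suc n) (λ j → + (suc n C suc j) * (x - 1ℤ) ^ j * Ã x (n ∸ j)) + x ^ suc n
    ≡⟨ cong (_+ x ^ suc n) (sym (∑₁≡∑< (suc n) (λ j → (+ (suc n C j)) * ((x - 1ℤ) ^ (j ∸ 1)) * Ã x (suc n ∸ j)))) ⟩
  ∑₁ (suc n) (λ j → (+ (suc n C j)) * ((x - 1ℤ) ^ (j ∸ 1)) * Ã x (suc n ∸ j)) + x ^ suc n ∎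
  where open ≡-Reasoning
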